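{- Let $A,B$ be conjunctions of $\mathcal{LA}(\mathbb{Z})$ equalities and inequalities, let $c\in\mathbb{Z}$ with $c>0$, and suppose $(A,B)\vdash (c\le 0)\,[I]$ is a valid annotated sequent. Then $\varphi_I := \bigvee_{\langle t_i\le 0,E_i\rangle\in I}((t_i\le 0)\wedge E_i)$ is a Craig interpolant for $(A,B)$, i.e. $A\models\varphi_I$, $\varphi_I\wedge B$ is unsatisfiable in $\mathcal{LA}(\mathbb{Z})$, and $\varphi_I\preceq A$ and $\varphi_I\preceq B$.
   Context: $\mathcal{LA}(\mathbb{Z})$ is linear arithmetic over the integers: variables range over $\mathbb{Z}$, terms are integer linear combinations of variables plus an integer constant, and $\models$ is entailment over integer assignments. A modular equation $t=_g0$ means $g$ divides $t$ ($=_0$ is equality). $\phi\preceq\psi$ means every variable occurring in $\phi$ occurs in $\psi$. An annotated sequent $(A,B)\vdash (t\le 0)[I]$ consists of conjunctions $A,B$ of equalities/inequalities, a linear term $t$, and a set $I$ of pairs $\langle t_i\le 0,E_i\rangle$ where $t_i$ is a linear term and $E_i$ is a (possibly empty) conjunction of equalities and modular equalities. It is valid when: (1) $A\models\bigvee_{\langle t_i\le0,E_i\rangle\in I}((t_i\le0)\wedge E_i)$; (2) for all $\langle t_i\le0,E_i\rangle\in I$, $B\wedge E_i\models(t-t_i\le 0)$; (3) for all such pairs, $t_i\preceq A$, $(t-t_i)\preceq B$, $E_i\preceq A$, $E_i\preceq B$. -}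

module Defs where

open import Data.Nat using (ℕ; zero; suc)
open import Data.Integer using (ℤ; +_; _+_; _*_; -_; _≤_; _-_)
open import Data.Integer.Divisibility using (_∣_)
open import Data.List using (List; []; _∷_)
open import Data.List.Relation.Unary.All using (All)
open import Data.List.Relation.Unary.Any using (Any)
open import Data.Product using (_×_; Σ; _,_)
open import Relation.Binary.PropositionalEquality using (_≡_; _≢_)

Assignment : Set
Assignment = ℕ → ℤ

-- A linear term  c + Σ_i a_i x_i : coefficient list (entry i is the
-- coefficient of variable x_i; entries beyond the list are 0) and constant.
record Term : Set where
  constructor mkTerm
  field
    coeffs : List ℤ
    const  : ℤ
open Term public

coeff : List ℤ → ℕ → ℤ
coeff []       _       = + 0
coeff (a ∷ as) zero    = a
coeff (a ∷ as) (suc i) = coeff as i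

evalLin : List ℤ → (ℕ → ℤ) → ℤ
evalLin []       σ = + 0
evalLin (a ∷ as) σ = a * σ zero + evalLin as (λ i → σ (suc i))

eval : Term → Assignment → ℤ
eval t σ = evalLin (coeffs t) σ + const t

subL : List ℤ → List ℤ → List ℤ
subL []       []       = []
subL []       (b ∷ bs) = (- b) ∷ subL [] bs
subL (a ∷ as) []       = a ∷ subL as []
subL (a ∷ as) (b ∷ bs) = (a - b) ∷ subL as bs

_⊖_ : Term → Term → Term
t ⊖ u = mkTerm (subL (coeffs t) (coeffs u)) (const t - const u)

constTerm : ℤ → Term
constTerm c = mkTerm [] c

OccursT : ℕ → Term → Set
OccursT x t = coeff (coeffs t) x ≢ + 0

data Atom : Set where
  eq0 : Term → Atom
  le0 : Term → Atom

atomTerm : Atom → Term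
atomTerm (eq0 t) = t
atomTerm (le0 t) = t

SatAtom : Assignment → Atom → Set
SatAtom σ (eq0 t) = eval t σ ≡ + 0
SatAtom σ (le0 t) = eval t σ ≤ + 0

Conj : Set
Conj = List Atom

SatConj : Assignment → Conj → Set
SatConj σ A = All (SatAtom σ) A

OccursC : ℕ → Conj → Set
OccursC x A = Any (λ a → OccursT x (atomTerm a)) A

-- Modular equalities t =_g 0 (g divides t; g = 0 means ordinary equality).
record ModEq : Set where
  constructor _=[_]0
  field
    mterm : Term
    modulus : ℕ
open ModEq public

SatModEq : Assignment → ModEq → Set
SatModEq σ e = + (modulus e) ∣ eval (mterm e) σ

ModConj : Set
ModConj = List ModEq

SatModConj : Assignment → ModConj → Set
SatModConj σ E = All (SatModEq σ) E

OccursM : ℕ → ModConj → Set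
OccursM x E = Any (λ e → OccursT x (mterm e)) E

_⪯_ : (ℕ → Set) → (ℕ → Set) → Set
P ⪯ Q = ∀ x → P x → Q x

Annot : Set
Annot = Term × ModConj

SatAnnot : Assignment → Annot → Set
SatAnnot σ (ti , Ei) = (eval ti σ ≤ + 0) × SatModConj σ Ei

SatPhi : Assignment → List Annot → Set
SatPhi σ I = Any (SatAnnot σ) I

OccursAnnot : ℕ → Annot → Set
OccursAnnot x (ti , Ei) = OccursT x ti Data.Sum.⊎ OccursM x Ei
  where import Data.Sum

OccursPhi : ℕ → List Annot → Set
OccursPhi x I = Any (OccursAnnot x) I

record ValidSequent (A B : Conj) (t : Term) (I : List Annot) : Set where
  field
    cond1 : ∀ σ → SatConj σ A → SatPhi σ I
    cond2 : All (λ { (ti , Ei) → ∀ σ → SatConj σ B → SatModConj σ Ei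
                                      → eval (t ⊖ ti) σ ≤ + 0 }) I
    cond3 : All (λ { (ti , Ei) →
                  ((λ x → OccursT x ti) ⪯ (λ x → OccursC x A))
                × ((λ x → OccursT x (t ⊖ ti)) ⪯ (λ x → OccursC x B))
                × ((λ x → OccursM x Ei) ⪯ (λ x → OccursC x A))
                × ((λ x → OccursM x Ei) ⪯ (λ x → OccursC x B)) }) I

-- Every disjunct of φ_I is refuted
-- by B: if t_i ≤ 0 and E_i hold together with B, condition (2) gives
-- c − t_i ≤ 0, hence c ≤ t_i ≤ 0, contradicting c > 0.  The variables of
-- t_i are those of c − t_i, which lie in B by condition (3); those of E_i
-- lie in A and B directly by condition (3).
module Submission where

open import Defs
open import Data.Integer using (ℤ; +_; _>_)
open import Data.List using (List)
open import Data.Product using (_×_; Σ)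
open import Relation.Nullary using (¬_)

open import Data.Nat using (zero; suc)
open import Data.Integer using (_-_; -_; _≤_)
open import Data.Integer.Properties
  using (+-identityˡ; +-identityʳ; i-j≡0⇒i≡j; i-j≤0⇒i≤j; ≤-trans; <-irrefl; <-≤-trans)
open import Data.Integer.Solver using (module +-*-Solver)
open import Data.List using ([]; _∷_)
open import Data.List.Relation.Unary.All using (lookupWith)
open import Data.Product using (_,_)
open import Data.Sum using (inj₁; inj₂)
open import Data.Empty using (⊥)
open import Relation.Binary.PropositionalEquality using (_≡_; refl; sym; trans; cong; subst)
open +-*-Solver

coeff-subL : ∀ as bs x → coeff (subL as bs) x ≡ coeff as x - coeff bs x
coeff-subL []       []       x       = refl
coeff-subL []       (b ∷ bs) zero    = sym (+-identityˡ (- b))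
coeff-subL []       (b ∷ bs) (suc x) = coeff-subL [] bs x
coeff-subL (a ∷ as) []       zero    = sym (+-identityʳ a)
coeff-subL (a ∷ as) []       (suc x) = coeff-subL as [] x
coeff-subL (a ∷ as) (b ∷ bs) zero    = refl
coeff-subL (a ∷ as) (b ∷ bs) (suc x) = coeff-subL as bs x

evalLin-subL : ∀ as bs (σ : Assignment) →
               evalLin (subL as bs) σ ≡ evalLin as σ - evalLin bs σ
evalLin-subL [] [] σ = refl
evalLin-subL [] (b ∷ bs) σ rewrite evalLin-subL [] bs (λ i → σ (suc i)) =
  solve 3 (λ b s r → (:- b) :* s :+ (con (+ 0) :- r) := con (+ 0) :- (b :* s :+ r))
    refl b (σ zero) (evalLin bs (λ i → σ (suc i)))
evalLin-subL (a ∷ as) [] σ rewrite evalLin-subL as [] (λ i → σ (suc i)) =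
  solve 3 (λ a s l → a :* s :+ (l :- con (+ 0)) := (a :* s :+ l) :- con (+ 0))
    refl a (σ zero) (evalLin as (λ i → σ (suc i)))
evalLin-subL (a ∷ as) (b ∷ bs) σ rewrite evalLin-subL as bs (λ i → σ (suc i)) =
  solve 5 (λ a b s l r → (a :- b) :* s :+ (l :- r) := (a :* s :+ l) :- (b :* s :+ r))
    refl a b (σ zero) (evalLin as (λ i → σ (suc i))) (evalLin bs (λ i → σ (suc i)))

eval-⊖ : ∀ t u σ → eval (t ⊖ u) σ ≡ eval t σ - eval u σ
eval-⊖ t u σ rewrite evalLin-subL (coeffs t) (coeffs u) σ =
  solve 4 (λ l k m n → (l :- m) :+ (k :- n) := (l :+ k) :- (m :+ n))
    refl (evalLin (coeffs t) σ) (const t) (evalLin (coeffs u) σ) (const u)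

OccursT-⊖ʳ : ∀ {x} t u → coeff (coeffs t) x ≡ + 0 → OccursT x u → OccursT x (t ⊖ u)
OccursT-⊖ʳ {x} t u t∌x u∋x t⊖u∌x = u∋x (trans (sym coeffs-agree) t∌x)
  where
  coeffs-agree : coeff (coeffs t) x ≡ coeff (coeffs u) x
  coeffs-agree = i-j≡0⇒i≡j _ _ (trans (sym (coeff-subL (coeffs t) (coeffs u) x)) t⊖u∌x)

eval-constTerm-⊖ : ∀ c t σ → eval (constTerm c ⊖ t) σ ≡ c - eval t σ
eval-constTerm-⊖ c t σ = trans (eval-⊖ (constTerm c) t σ) (cong (_- eval t σ) (+-identityˡ c))

constTerm-⊖-refutes : ∀ {c} t σ → c > + 0 → eval (constTerm c ⊖ t) σ ≤ + 0 → ¬ (eval t σ ≤ + 0)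
constTerm-⊖-refutes {c} t σ c>0 c⊖t≤0 t≤0 =
  <-irrefl refl (<-≤-trans c>0 (≤-trans c≤t t≤0))
  where
  c≤t : c ≤ eval t σ
  c≤t = i-j≤0⇒i≤j (subst (_≤ + 0) (eval-constTerm-⊖ c t σ) c⊖t≤0)

corollary3p6 : (A B : Conj) (c : ℤ) (I : List Annot)
    → c > + 0
    → ValidSequent A B (constTerm c) I
    → (∀ σ → SatConj σ A → SatPhi σ I)
    × (¬ (Σ Assignment (λ σ → SatPhi σ I × SatConj σ B)))
    × ((λ x → OccursPhi x I) ⪯ (λ x → OccursC x A))
    × ((λ x → OccursPhi x I) ⪯ (λ x → OccursC x B))
corollary3p6 A B c I c>0 V =
    cond1
  , (λ (σ , σ⊨φ , σ⊨B) → lookupWith {R = λ _ → ⊥}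
      (λ { {t , _} c⊖t≤0 (t≤0 , σ⊨E) → constTerm-⊖-refutes t σ c>0 (c⊖t≤0 σ σ⊨B σ⊨E) t≤0 })
      cond2 σ⊨φ)
  , (λ x → lookupWith {R = λ _ → OccursC x A}
      (λ { (t⪯A , _ , _ , _) (inj₁ t∋x) → t⪯A x t∋x
         ; (_ , _ , E⪯A , _) (inj₂ E∋x) → E⪯A x E∋x })
      cond3)
  , (λ x → lookupWith {R = λ _ → OccursC x B}
      (λ { {t , _} (_ , c⊖t⪯B , _ , _) (inj₁ t∋x) →
             c⊖t⪯B x (OccursT-⊖ʳ (constTerm c) t refl t∋x)
         ; (_ , _ , _ , E⪯B) (inj₂ E∋x) → E⪯B x E∋x })
      cond3)
  where open ValidSequent V
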